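{- Let $p>3$ be a prime and $s$ a positive integer. Then $$\sum_{k=0}^{\frac{p-1}{2}}\left(\frac{(\frac12)_k}{k!}\right)^{2s} H_{2k}^{(2)}\equiv 0\pmod p,$$ where $H_m^{(2)}=\sum_{j=1}^m \frac{1}{j^2}$ (so $H_0^{(2)}=0$).
   Context: For $a\in\mathbb{C}$ and $k\in\mathbb{N}$, $(a)_k=a(a+1)\cdots(a+k-1)$ denotes the rising factorial, with $(a)_0=1$. A congruence $A\equiv B \pmod{p^m}$ between rational numbers means that $A-B\in p^m\mathbb{Z}_{(p)}$. -}

module Defs where

open import Data.Nat as ℕ using (ℕ; zero; suc; NonZero)
open import Data.Nat using (_!)
open import Data.Nat.Properties using (_!≢0)
open import Data.Nat.Divisibility as ℕD using ()
open import Data.Integer as ℤ using (ℤ; +_)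
open import Data.Rational as ℚ using (ℚ; _+_; _*_; _-_; _/_; 0ℚ; 1ℚ; ↥_; ↧ₙ_)
open import Relation.Nullary using (¬_)
open import Data.Product using (_×_)

sumTo : ℕ → (ℕ → ℚ) → ℚ
sumTo zero    f = f 0
sumTo (suc n) f = sumTo n f + f (suc n)

_^ℚ_ : ℚ → ℕ → ℚ
x ^ℚ zero    = 1ℚ
x ^ℚ (suc n) = x * (x ^ℚ n)

rising : ℚ → ℕ → ℚ
rising a zero    = 1ℚ
rising a (suc k) = rising a k * (a + ((+ k) / 1))

half : ℚ
half = (+ 1) / 2

invFact : ℕ → ℚ
invFact k = (+ 1) / (k !)
  where instance _ = k !≢0

H2 : ℕ → ℚ
H2 zero    = 0ℚ
H2 (suc m) = H2 m + ((+ 1) / (suc m ℕ.* suc m))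

-- A ≡ B (mod p^m) for rationals: A - B ∈ p^m ℤ_(p).  With A - B = n/d in
-- lowest terms (d > 0), this means p^m ∣ n and p ∤ d.
_≡_[modℚ_^_] : ℚ → ℚ → ℕ → ℕ → Set
A ≡ B [modℚ p ^ m ] =
  ((p ℕ.^ m) ℕD.∣ ℤ.∣ ↥ (A - B) ∣) × ¬ (p ℕD.∣ (↧ₙ (A - B)))

module Submission where

-- Work modulo p with n = (p − 1)/2, writing H for H⁽²⁾.  Since 1/2 ≡ −n, (1/2)_k/k! ≡ (−1)^k C(n,k),
-- so ((1/2)_k/k!)^{2s} is invariant under k ↦ n − k.  Pairing j with p − j gives
-- H_{2n−m} + H_m ≡ H_{p−1}, and H_{p−1} ≡ 0 because j ↦ 2j permutes the nonzero residues, so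
-- H_{p−1} ≡ 4 H_{p−1} with p > 3.  Hence H_{2(n−k)} ≡ −H_{2k}, the summand changes sign under
-- k ↦ n − k, and the sum S satisfies S ≡ −S, so S ≡ 0 as p is odd.

open import Defs

-- ℤ's _*_ is opened only in this local scope, so that the statement at the end reads ℕ's _*_.
module _ where

  open import Data.Nat as ℕ using (ℕ; zero; suc; _∸_; _!; NonZero)
  open import Data.Nat.Combinatorics using (_C_; nCk≡n!/k![n-k]!; nCk≡nC[n∸k]; k![n∸k]!∣n!)
  open import Data.Nat.DivMod using (m/n*n≡m; m%n<n; m≡m%n+[m/n]*n)
  import Data.Nat.Properties as ℕP
  open import Data.Nat.Properties using (_!≢0; _!*_!≢0)
  import Data.Nat.Divisibility as ℕD
  open import Data.Integer as ℤ using (ℤ; _^_; +_; 0ℤ; 1ℤ; -1ℤ; _+_; _*_; -_; _-_)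
  import Data.Integer.Properties as ℤP
  open import Data.Integer.GCD using (gcd)
  open import Data.Rational using (ℚ; mkℚ; ↥_; ↧_; ↧ₙ_; 0ℚ)
  import Data.Rational.Properties as ℚP
  open import Data.Integer.Divisibility.Signed using (_∣_; divides; ∣ᵤ⇒∣; ∣⇒∣ᵤ; ∣m∣n⇒∣m+n; ∣m⇒∣-m; ∣n⇒∣m*n; ∣m⇒∣m*n)
  open import Data.Integer.Tactic.RingSolver using (solve-∀)
  import Data.Nat.Tactic.RingSolver as ℕSolver
  open import Data.Nat.Primality using (Prime; prime⇒nonTrivial; euclidsLemma; prime⇒irreducible)
  open import Data.Nat.GCD using (module GCD; module Bézout)
  open import Data.Nat.Coprimality using (Coprime; coprime⇒GCD≡1)
  open import Data.Product using (_×_; _,_)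
  open import Data.Sum using (_⊎_; inj₁; inj₂; [_,_]′)
  open import Data.Empty using (⊥-elim)
  open import Relation.Nullary using (¬_)
  open import Function using (id; _∘_; _⇔_; mk⇔; Equivalence)
  open import Relation.Binary.Bundles using (Setoid)
  import Relation.Binary.Reasoning.Setoid as SetoidReasoning
  open import Relation.Binary.Structures using (IsEquivalence)
  open import Relation.Binary.PropositionalEquality using (_≡_; refl; sym; trans; cong; cong₂; subst; module ≡-Reasoning)

  Σ< : ℕ → (ℕ → ℤ) → ℤ
  Σ< zero    f = 0ℤ
  Σ< (suc m) f = Σ< m f + f m

  Σ<-cong : ∀ m {f g} → (∀ i → i ℕ.< m → f i ≡ g i) → Σ< m f ≡ Σ< m g
  Σ<-cong zero    f≡g = refl
  Σ<-cong (suc m) f≡g = cong₂ _+_ (Σ<-cong m (λ i i<m → f≡g i (ℕP.m<n⇒m<1+n i<m))) (f≡g m ℕP.≤-refl)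

  Σ<-suc : ∀ m f → Σ< (suc m) f ≡ f 0 + Σ< m (f ∘ suc)
  Σ<-suc zero    f = ℤP.+-comm 0ℤ (f 0)
  Σ<-suc (suc m) f = trans (cong (_+ f (suc m)) (Σ<-suc m f)) (ℤP.+-assoc (f 0) _ _)

  Σ<-reverse : ∀ m f → Σ< m (λ i → f (m ∸ suc i)) ≡ Σ< m f
  Σ<-reverse zero    f = refl
  Σ<-reverse (suc m) f = begin
    Σ< m (λ i → f (m ∸ i)) + f (m ∸ m)      ≡⟨ cong₂ _+_ (Σ<-cong m (λ i i<m → cong f (ℕP.+-∸-assoc 1 i<m)))
                                                          (cong f (ℕP.n∸n≡0 m)) ⟩
    Σ< m (λ i → f (suc (m ∸ suc i))) + f 0  ≡⟨ cong (_+ f 0) (Σ<-reverse m (f ∘ suc)) ⟩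
    Σ< m (f ∘ suc) + f 0                    ≡⟨ ℤP.+-comm _ (f 0) ⟩
    f 0 + Σ< m (f ∘ suc)                    ≡⟨ Σ<-suc m f ⟨
    Σ< (suc m) f                            ∎
    where open ≡-Reasoning

  Σ<-split : ∀ a b f → Σ< (a ℕ.+ b) f ≡ Σ< a f + Σ< b (λ i → f (a ℕ.+ i))
  Σ<-split a zero    f = trans (cong (λ m → Σ< m f) (ℕP.+-identityʳ a)) (sym (ℤP.+-identityʳ _))
  Σ<-split a (suc b) f = begin
    Σ< (a ℕ.+ suc b) f                                 ≡⟨ cong (λ m → Σ< m f) (ℕP.+-suc a b) ⟩
    Σ< (a ℕ.+ b) f + f (a ℕ.+ b)                       ≡⟨ cong (_+ f (a ℕ.+ b)) (Σ<-split a b f) ⟩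
    (Σ< a f + Σ< b (λ i → f (a ℕ.+ i))) + f (a ℕ.+ b)  ≡⟨ ℤP.+-assoc (Σ< a f) _ _ ⟩
    Σ< a f + Σ< (suc b) (λ i → f (a ℕ.+ i))            ∎
    where open ≡-Reasoning

  Σ<-even-odd : ∀ a f → Σ< (a ℕ.+ a) f ≡ Σ< a (λ i → f (i ℕ.+ i)) + Σ< a (λ i → f (suc (i ℕ.+ i)))
  Σ<-even-odd zero    f = refl
  Σ<-even-odd (suc a) f = begin
    Σ< (suc a ℕ.+ suc a) f
      ≡⟨ cong (λ m → Σ< (suc m) f) (ℕP.+-suc a a) ⟩
    Σ< (a ℕ.+ a) f + f (a ℕ.+ a) + f (suc (a ℕ.+ a))
      ≡⟨ cong (λ s → s + f (a ℕ.+ a) + f (suc (a ℕ.+ a))) (Σ<-even-odd a f) ⟩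
    evens + odds + f (a ℕ.+ a) + f (suc (a ℕ.+ a))
      ≡⟨ interchange evens odds (f (a ℕ.+ a)) (f (suc (a ℕ.+ a))) ⟩
    (evens + f (a ℕ.+ a)) + (odds + f (suc (a ℕ.+ a)))
      ∎
    where
    open ≡-Reasoning
    evens odds : ℤ
    evens = Σ< a (λ i → f (i ℕ.+ i))
    odds  = Σ< a (λ i → f (suc (i ℕ.+ i)))
    interchange : ∀ x y u v → x + y + u + v ≡ (x + u) + (y + v)
    interchange = solve-∀

  *-distribˡ-Σ< : ∀ m c f → c * Σ< m f ≡ Σ< m (λ i → c * f i)
  *-distribˡ-Σ< zero    c f = ℤP.*-zeroʳ c
  *-distribˡ-Σ< (suc m) c f = trans (ℤP.*-distribˡ-+ c (Σ< m f) (f m)) (cong (_+ c * f m) (*-distribˡ-Σ< m c f))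

  neg-distrib-Σ< : ∀ m f → - Σ< m f ≡ Σ< m (λ i → - f i)
  neg-distrib-Σ< zero    f = refl
  neg-distrib-Σ< (suc m) f = trans (ℤP.neg-distrib-+ (Σ< m f) (f m)) (cong (_+ - f m) (neg-distrib-Σ< m f))

  risingℤ : ℤ → ℕ → ℤ
  risingℤ a zero    = 1ℤ
  risingℤ a (suc k) = risingℤ a k * (a + + k)

  [-n]ₖ*[n∸k]!≡[-1]^k*n! : ∀ n k → k ℕ.≤ n → risingℤ (- + n) k * + ((n ∸ k) !) ≡ -1ℤ ^ k * + (n !)
  [-n]ₖ*[n∸k]!≡[-1]^k*n! n zero    _   = refl
  [-n]ₖ*[n∸k]!≡[-1]^k*n! n (suc k) k<n = begin
    risingℤ (- + n) k * (- + n + + k) * + (m !)  ≡⟨ cong (λ t → risingℤ (- + n) k * (- t + + k) * + (m !)) n≡1+k+m ⟩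
    risingℤ (- + n) k * (- (1ℤ + + k + + m) + + k) * + (m !)
                                                     ≡⟨ regroup (risingℤ (- + n) k) (+ k) (+ m) (+ (m !)) ⟩
    -1ℤ * (risingℤ (- + n) k * ((1ℤ + + m) * + (m !)))
                                                     ≡⟨ cong (λ t → -1ℤ * (risingℤ (- + n) k * t)) [1+m]m!≡[n∸k]! ⟩
    -1ℤ * (risingℤ (- + n) k * + ((n ∸ k) !))  ≡⟨ cong (-1ℤ *_) ([-n]ₖ*[n∸k]!≡[-1]^k*n! n k (ℕP.<⇒≤ k<n)) ⟩
    -1ℤ * (-1ℤ ^ k * + (n !))                  ≡⟨ ℤP.*-assoc -1ℤ (-1ℤ ^ k) (+ (n !)) ⟨
    -1ℤ ^ suc k * + (n !)                      ∎
    where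
    open ≡-Reasoning
    m : ℕ
    m = n ∸ suc k
    n≡1+k+m : + n ≡ 1ℤ + + k + + m
    n≡1+k+m = trans (cong +_ (sym (ℕP.m+[n∸m]≡n k<n))) (trans (ℤP.pos-+ (suc k) m) (cong (_+ + m) (ℤP.pos-+ 1 k)))
    [1+m]m!≡[n∸k]! : (1ℤ + + m) * + (m !) ≡ + ((n ∸ k) !)
    [1+m]m!≡[n∸k]! = trans (sym (ℤP.pos-* (suc m) (m !))) (cong (λ t → + (t !)) (sym (ℕP.+-∸-assoc 1 k<n)))
    regroup : ∀ r k m f → r * (- (1ℤ + k + m) + k) * f ≡ -1ℤ * (r * ((1ℤ + m) * f))
    regroup = solve-∀

  nCk*k![n∸k]!≡n! : ∀ {n k} → k ℕ.≤ n → (n C k) ℕ.* (k ! ℕ.* (n ∸ k) !) ≡ n !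
  nCk*k![n∸k]!≡n! {n} {k} k≤n =
    trans (cong (ℕ._* (k ! ℕ.* (n ∸ k) !)) (nCk≡n!/k![n-k]! k≤n))
          (m/n*n≡m {{k !* (n ∸ k) !≢0}} (k![n∸k]!∣n! k≤n))

  [-1]^k*x^[2s]≡x^[2s] : ∀ k s x → (-1ℤ ^ k * x) ^ (2 ℕ.* s) ≡ x ^ (2 ℕ.* s)
  [-1]^k*x^[2s]≡x^[2s] k s x = begin
    (-1ℤ ^ k * x) ^ (2 ℕ.* s)  ≡⟨ ℤP.^-*-assoc (-1ℤ ^ k * x) 2 s ⟨
    ((-1ℤ ^ k * x) ^ 2) ^ s    ≡⟨ cong (_^ s) (sign-squared k) ⟩
    (x ^ 2) ^ s                ≡⟨ ℤP.^-*-assoc x 2 s ⟩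
    x ^ (2 ℕ.* s)              ∎
    where
    open ≡-Reasoning
    sign-squared : ∀ k → (-1ℤ ^ k * x) ^ 2 ≡ x ^ 2
    sign-squared zero    = cong (_^ 2) (ℤP.*-identityˡ x)
    sign-squared (suc k) = trans (drop-sign (-1ℤ ^ k) x) (sign-squared k)
      where
      drop-sign : ∀ e x → (-1ℤ * e * x) * ((-1ℤ * e * x) * 1ℤ) ≡ (e * x) * ((e * x) * 1ℤ)
      drop-sign = solve-∀

  2*x≡x+x : ∀ x → 2 ℕ.* x ≡ x ℕ.+ x
  2*x≡x+x x = cong (x ℕ.+_) (ℕP.+-identityʳ x)

  odd-prime≡1+2[p∸1]/2 : ∀ {p} → Prime p → 2 ℕ.< p → p ≡ suc ((p ∸ 1) ℕ./ 2 ℕ.+ (p ∸ 1) ℕ./ 2)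
  odd-prime≡1+2[p∸1]/2 {suc q} p-prime 2<p with q ℕ.% 2 | m%n<n q 2 | m≡m%n+[m/n]*n q 2
  ... | 0 | _ | q≡[q/2]*2 = cong suc (trans q≡[q/2]*2 (trans (ℕP.*-comm (q ℕ./ 2) 2) (2*x≡x+x (q ℕ./ 2))))
  ... | 1 | _ | q≡1+[q/2]*2 with prime⇒irreducible p-prime (ℕD.divides (suc (q ℕ./ 2)) (cong suc q≡1+[q/2]*2))
  ...   | inj₂ refl = ⊥-elim (ℕP.<-irrefl refl 2<p)
  odd-prime≡1+2[p∸1]/2 {suc q} p-prime 2<p | suc (suc _) | ℕ.s≤s (ℕ.s≤s ()) | _

  module Congruence (m : ℕ) where

    infix 4 _≋_
    record _≋_ (a b : ℤ) : Set where
      constructor ≋-intro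
      field divides-difference : + m ∣ a - b
    open _≋_

    private
      ≋-via : ∀ {a b x} → x ≡ a - b → + m ∣ x → a ≋ b
      ≋-via x≡a-b m∣x = ≋-intro (subst (+ m ∣_) x≡a-b m∣x)

    ≋-reflexive : ∀ {a b} → a ≡ b → a ≋ b
    ≋-reflexive {a} refl = ≋-intro (divides 0ℤ (ℤP.+-inverseʳ a))

    ≋-refl : ∀ {a} → a ≋ a
    ≋-refl = ≋-reflexive refl

    ≋-sym : ∀ {a b} → a ≋ b → b ≋ a
    ≋-sym {a} {b} (≋-intro a-b) = ≋-via (swap a b) (∣m⇒∣-m a-b)
      where
      swap : ∀ a b → - (a - b) ≡ b - a
      swap = solve-∀

    ≋-trans : ∀ {a b c} → a ≋ b → b ≋ c → a ≋ c
    ≋-trans {a} {b} {c} (≋-intro a-b) (≋-intro b-c) = ≋-via (telescope a b c) (∣m∣n⇒∣m+n a-b b-c)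
      where
      telescope : ∀ a b c → (a - b) + (b - c) ≡ a - c
      telescope = solve-∀

    ≋-isEquivalence : IsEquivalence _≋_
    ≋-isEquivalence = record { refl = ≋-refl ; sym = ≋-sym ; trans = ≋-trans }

    ≋-setoid : Setoid _ _
    ≋-setoid = record { isEquivalence = ≋-isEquivalence }

    module ≋-Reasoning = SetoidReasoning ≋-setoid

    +-cong : ∀ {a b c d} → a ≋ b → c ≋ d → a + c ≋ b + d
    +-cong {a} {b} {c} {d} (≋-intro a-b) (≋-intro c-d) = ≋-via (regroup a b c d) (∣m∣n⇒∣m+n a-b c-d)
      where
      regroup : ∀ a b c d → (a - b) + (c - d) ≡ (a + c) - (b + d)
      regroup = solve-∀

    *-cong : ∀ {a b c d} → a ≋ b → c ≋ d → a * c ≋ b * d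
    *-cong {a} {b} {c} {d} (≋-intro a-b) (≋-intro c-d) =
      ≋-via (expand a b c d) (∣m∣n⇒∣m+n (∣m⇒∣m*n c a-b) (∣n⇒∣m*n b c-d))
      where
      expand : ∀ a b c d → (a - b) * c + b * (c - d) ≡ a * c - b * d
      expand = solve-∀

    neg-cong : ∀ {a b} → a ≋ b → - a ≋ - b
    neg-cong {a} {b} (≋-intro a-b) = ≋-via (neg-minus a b) (∣m⇒∣-m a-b)
      where
      neg-minus : ∀ a b → - (a - b) ≡ - a - - b
      neg-minus = solve-∀

    ≋⇔-≋0 : ∀ {a b} → a ≋ b ⇔ a - b ≋ 0ℤ
    ≋⇔-≋0 {a} {b} = mk⇔ (≋-via (sym (ℤP.+-identityʳ (a - b))) ∘ divides-difference)
                        (≋-via (ℤP.+-identityʳ (a - b)) ∘ divides-difference)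

    m≋0 : + m ≋ 0ℤ
    m≋0 = ≋-intro (divides 1ℤ (trans (ℤP.+-identityʳ (+ m)) (sym (ℤP.*-identityˡ (+ m)))))

    ≋0⇔∣ : ∀ {a} → a ≋ 0ℤ ⇔ m ℕD.∣ ℤ.∣ a ∣
    ≋0⇔∣ {a} = mk⇔ (λ a≋0 → ∣⇒∣ᵤ (subst (+ m ∣_) (ℤP.+-identityʳ a) (divides-difference a≋0)))
                   (≋-via (sym (ℤP.+-identityʳ a)) ∘ ∣ᵤ⇒∣)

    +≋0⇒≋- : ∀ {a b} → a + b ≋ 0ℤ → a ≋ - b
    +≋0⇒≋- {a} {b} a+b≋0 = begin
      a              ≡⟨ shift a b ⟩
      (a + b) + - b  ≈⟨ +-cong a+b≋0 ≋-refl ⟩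
      0ℤ + - b       ≡⟨ ℤP.+-identityˡ (- b) ⟩
      - b            ∎
      where
      open ≋-Reasoning
      shift : ∀ a b → a ≡ (a + b) + - b
      shift = solve-∀

    ^-cong : ∀ {a b} k → a ≋ b → a ^ k ≋ b ^ k
    ^-cong zero    a≋b = ≋-refl
    ^-cong (suc k) a≋b = *-cong a≋b (^-cong k a≋b)

    risingℤ-cong : ∀ {a b} k → a ≋ b → risingℤ a k ≋ risingℤ b k
    risingℤ-cong zero    a≋b = ≋-refl
    risingℤ-cong (suc k) a≋b = *-cong (risingℤ-cong k a≋b) (+-cong a≋b ≋-refl)

    Σ<-cong-≋ : ∀ n {f g} → (∀ i → i ℕ.< n → f i ≋ g i) → Σ< n f ≋ Σ< n g
    Σ<-cong-≋ zero    f≋g = ≋-refl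
    Σ<-cong-≋ (suc n) f≋g = +-cong (Σ<-cong-≋ n (λ i i<n → f≋g i (ℕP.m<n⇒m<1+n i<n))) (f≋g n ℕP.≤-refl)

  module PrimeModulus (p : ℕ) (p-prime : Prime p) where

    open Congruence p public
    open Equivalence using (to; from)

    ∤⇒≉0 : ∀ {m} → ¬ p ℕD.∣ m → ¬ + m ≋ 0ℤ
    ∤⇒≉0 p∤m = p∤m ∘ to ≋0⇔∣

    *≋0⇒≋0⊎≋0 : ∀ {a b} → a * b ≋ 0ℤ → a ≋ 0ℤ ⊎ b ≋ 0ℤ
    *≋0⇒≋0⊎≋0 {a} {b} ab≋0
      with euclidsLemma ℤ.∣ a ∣ ℤ.∣ b ∣ p-prime (subst (p ℕD.∣_) (ℤP.abs-* a b) (to ≋0⇔∣ ab≋0))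
    ... | inj₁ p∣a = inj₁ (from ≋0⇔∣ p∣a)
    ... | inj₂ p∣b = inj₂ (from ≋0⇔∣ p∣b)

    *-cancelʳ-≋ : ∀ {a b u} → ¬ u ≋ 0ℤ → a * u ≋ b * u → a ≋ b
    *-cancelʳ-≋ {a} {b} {u} u≉0 au≋bu =
      [ from ≋⇔-≋0 , ⊥-elim ∘ u≉0 ]′
        (*≋0⇒≋0⊎≋0 (≋-trans (≋-reflexive (distrib a b u)) (to ≋⇔-≋0 au≋bu)))
      where
      distrib : ∀ a b u → (a - b) * u ≡ a * u - b * u
      distrib = solve-∀

    unit-*≋0⇒≋0 : ∀ {k a} → ¬ p ℕD.∣ k → + k * a ≋ 0ℤ → a ≋ 0ℤ
    unit-*≋0⇒≋0 p∤k ka≋0 = [ ⊥-elim ∘ ∤⇒≉0 p∤k , id ]′ (*≋0⇒≋0⊎≋0 ka≋0)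

    ∤⇒coprime : ∀ {m} → ¬ p ℕD.∣ m → Coprime m p
    ∤⇒coprime p∤m (d∣m , d∣p) with prime⇒irreducible p-prime d∣p
    ... | inj₁ d≡1 = d≡1
    ... | inj₂ refl = ⊥-elim (p∤m d∣m)

    -- Read off a Bézout identity; a junk value when p ∣ m.
    inverse : ℕ → ℤ
    inverse m with Bézout.lemma m p
    ... | Bézout.result _ _ (Bézout.+- x _ _) = + x
    ... | Bézout.result _ _ (Bézout.-+ x _ _) = - + x

    *-inverse : ∀ {m} → ¬ p ℕD.∣ m → + m * inverse m ≋ 1ℤ
    *-inverse {m} p∤m with Bézout.lemma m p
    ... | Bézout.result _ isGCD _ with GCD.unique isGCD (coprime⇒GCD≡1 (∤⇒coprime p∤m))
    *-inverse {m} p∤m | Bézout.result _ _ (Bézout.+- x y eq) | refl =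
      ≋-intro (divides (+ y) (begin
        + m * + x - 1ℤ          ≡⟨ cong (_- 1ℤ) (trans (sym (ℤP.pos-* m x)) (cong +_ (ℕP.*-comm m x))) ⟩
        + (x ℕ.* m) - 1ℤ        ≡⟨ cong (λ t → + t - 1ℤ) eq ⟨
        + (1 ℕ.+ y ℕ.* p) - 1ℤ  ≡⟨ cong (_- 1ℤ) (trans (ℤP.pos-+ 1 (y ℕ.* p)) (cong (λ t → 1ℤ + t) (ℤP.pos-* y p))) ⟩
        1ℤ + + y * + p - 1ℤ     ≡⟨ cancel-1 (+ y * + p) ⟩
        + y * + p               ∎))
      where
      open ≡-Reasoning
      cancel-1 : ∀ t → 1ℤ + t - 1ℤ ≡ t
      cancel-1 = solve-∀
    *-inverse {m} p∤m | Bézout.result _ _ (Bézout.-+ x y eq) | refl =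
      ≋-intro (divides (- + y) (begin
        + m * - + x - 1ℤ     ≡⟨ rearrange (+ m) (+ x) ⟩
        - (1ℤ + + x * + m)   ≡⟨ cong -_ (trans (cong (λ t → 1ℤ + t) (sym (ℤP.pos-* x m))) (sym (ℤP.pos-+ 1 (x ℕ.* m)))) ⟩
        - + (1 ℕ.+ x ℕ.* m)  ≡⟨ cong (-_ ∘ +_) eq ⟩
        - + (y ℕ.* p)        ≡⟨ cong -_ (ℤP.pos-* y p) ⟩
        - (+ y * + p)        ≡⟨ ℤP.neg-distribˡ-* (+ y) (+ p) ⟩
        - + y * + p          ∎))
      where
      open ≡-Reasoning
      rearrange : ∀ m x → m * - x - 1ℤ ≡ - (1ℤ + x * m)
      rearrange = solve-∀

    inverse-unique : ∀ {m a} → ¬ p ℕD.∣ m → + m * a ≋ 1ℤ → a ≋ inverse m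
    inverse-unique {m} {a} p∤m ma≋1 = *-cancelʳ-≋ (∤⇒≉0 p∤m) (begin
      a * + m          ≡⟨ ℤP.*-comm a (+ m) ⟩
      + m * a          ≈⟨ ma≋1 ⟩
      1ℤ               ≈⟨ *-inverse p∤m ⟨
      + m * inverse m  ≡⟨ ℤP.*-comm (+ m) (inverse m) ⟩
      inverse m * + m  ∎)
      where open ≋-Reasoning

    Σ<-antisymmetric : ¬ p ℕD.∣ 2 → ∀ m f → (∀ i → i ℕ.< m → f (m ∸ suc i) ≋ - f i) → Σ< m f ≋ 0ℤ
    Σ<-antisymmetric p∤2 m f antisymmetric = unit-*≋0⇒≋0 p∤2 (begin
      + 2 * S                         ≡⟨ double S ⟩
      S + S                           ≡⟨ cong (_+ S) (Σ<-reverse m f) ⟨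
      Σ< m (λ i → f (m ∸ suc i)) + S  ≈⟨ +-cong (Σ<-cong-≋ m antisymmetric) ≋-refl ⟩
      Σ< m (λ i → - f i) + S          ≡⟨ cong (_+ S) (neg-distrib-Σ< m f) ⟨
      - S + S                         ≡⟨ ℤP.+-inverseˡ S ⟩
      0ℤ                              ∎)
      where
      open ≋-Reasoning
      S : ℤ
      S = Σ< m f
      double : ∀ s → + 2 * s ≡ s + s
      double = solve-∀

    ∤-* : ∀ {a b} → ¬ p ℕD.∣ a → ¬ p ℕD.∣ b → ¬ p ℕD.∣ a ℕ.* b
    ∤-* {a} {b} p∤a p∤b p∣ab = [ p∤a , p∤b ]′ (euclidsLemma a b p-prime p∣ab)

    ∤-<p : ∀ {x} → .{{NonZero x}} → x ℕ.< p → ¬ p ℕD.∣ x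
    ∤-<p x<p p∣x = ℕP.<⇒≱ x<p (ℕD.∣⇒≤ p∣x)

    p∤1 : ¬ p ℕD.∣ 1
    p∤1 = ∤-<p (ℕ.nonTrivial⇒n>1 p {{prime⇒nonTrivial p-prime}})

    ∤-! : ∀ {k} → k ℕ.< p → ¬ p ℕD.∣ k !
    ∤-! {zero}  _     = p∤1
    ∤-! {suc k} 1+k<p = ∤-* (∤-<p 1+k<p) (∤-! (ℕP.<-trans (ℕP.n<1+n k) 1+k<p))

    ∤-resp-≋ : ∀ {a b} → + a ≋ + b → ¬ p ℕD.∣ b → ¬ p ℕD.∣ a
    ∤-resp-≋ a≋b p∤b p∣a = ∤⇒≉0 p∤b (≋-trans (≋-sym a≋b) (from ≋0⇔∣ p∣a))

    inverse-cong : ∀ {a b} → ¬ p ℕD.∣ a → ¬ p ℕD.∣ b → + a ≋ + b → inverse a ≋ inverse b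
    inverse-cong {a} {b} p∤a p∤b a≋b = ≋-sym (inverse-unique p∤a (begin
      + a * inverse b  ≈⟨ *-cong a≋b ≋-refl ⟩
      + b * inverse b  ≈⟨ *-inverse p∤b ⟩
      1ℤ               ∎))
      where open ≋-Reasoning

  module Reduction (p : ℕ) (p-prime : Prime p) where

    open PrimeModulus p p-prime
    open Equivalence using (to; from)
    open import Data.Rational using (_/_) renaming (_+_ to _+ℚ_; _*_ to _*ℚ_)

    infix 4 _reducesTo_
    -- x is p-integral and r represents its image in ℤ/pℤ.
    record _reducesTo_ (x : ℚ) (r : ℤ) : Set where
      constructor reduction
      field
        denominator-∤ : ¬ p ℕD.∣ ↧ₙ x
        numerator-≋   : ↥ x ≋ r * ↧ x

    /-reducesTo : ∀ i n .{{_ : NonZero n}} {r} → ¬ p ℕD.∣ n → i ≋ r * + n → (i / n) reducesTo r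
    /-reducesTo i n {r} p∤n i≋rn = reduction p∤↧ (*-cancelʳ-≋ g≉0 (begin
        ↥ x * g        ≡⟨ ℚP.↥-/ i n ⟩
        i              ≈⟨ i≋rn ⟩
        r * + n        ≡⟨ cong (r *_) (ℚP.↧-/ i n) ⟨
        r * (↧ x * g)  ≡⟨ ℤP.*-assoc r (↧ x) g ⟨
        r * ↧ x * g    ∎))
      where
      open ≋-Reasoning
      x : ℚ
      x = i / n
      g : ℤ
      g = gcd i (+ n)
      p∤↧ : ¬ p ℕD.∣ ↧ₙ x
      p∤↧ p∣↧ = ∤⇒≉0 p∤n (begin
        + n      ≡⟨ ℚP.↧-/ i n ⟨
        ↧ x * g  ≈⟨ *-cong (from (≋0⇔∣ {↧ x}) p∣↧) ≋-refl ⟩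
        0ℤ * g   ≡⟨ ℤP.*-zeroˡ g ⟩
        0ℤ       ∎)
      g≉0 : ¬ g ≋ 0ℤ
      g≉0 g≋0 = ∤⇒≉0 p∤n (begin
        + n       ≡⟨ ℚP.↧-/ i n ⟨
        ↧ x * g   ≈⟨ *-cong (≋-refl {↧ x}) g≋0 ⟩
        ↧ x * 0ℤ  ≡⟨ ℤP.*-zeroʳ (↧ x) ⟩
        0ℤ        ∎)

    reducesTo-resp-≋ : ∀ {x r s} → x reducesTo r → r ≋ s → x reducesTo s
    reducesTo-resp-≋ {x} (reduction p∤↧ ↥≋) r≋s =
      reduction p∤↧ (≋-trans ↥≋ (*-cong r≋s (≋-refl {↧ x})))

    +-reducesTo : ∀ {x y r s} → x reducesTo r → y reducesTo s → x +ℚ y reducesTo r + s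
    +-reducesTo {x@(mkℚ _ _ _)} {y@(mkℚ _ _ _)} {r} {s} (reduction p∤↧x ↥x≋) (reduction p∤↧y ↥y≋) =
      /-reducesTo _ _ (∤-* p∤↧x p∤↧y) (begin
        ↥ x * ↧ y + ↥ y * ↧ x          ≈⟨ +-cong (*-cong ↥x≋ ≋-refl) (*-cong ↥y≋ ≋-refl) ⟩
        r * ↧ x * ↧ y + s * ↧ y * ↧ x  ≡⟨ collect r s (↧ x) (↧ y) ⟩
        (r + s) * (↧ x * ↧ y)          ≡⟨ cong ((r + s) *_) (ℤP.pos-* (↧ₙ x) (↧ₙ y)) ⟨
        (r + s) * + (↧ₙ x ℕ.* ↧ₙ y)    ∎)
      where
      open ≋-Reasoning
      collect : ∀ r s u v → r * u * v + s * v * u ≡ (r + s) * (u * v)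
      collect = solve-∀

    *-reducesTo : ∀ {x y r s} → x reducesTo r → y reducesTo s → x *ℚ y reducesTo r * s
    *-reducesTo {x@(mkℚ _ _ _)} {y@(mkℚ _ _ _)} {r} {s} (reduction p∤↧x ↥x≋) (reduction p∤↧y ↥y≋) =
      /-reducesTo _ _ (∤-* p∤↧x p∤↧y) (begin
        ↥ x * ↥ y                  ≈⟨ *-cong ↥x≋ ↥y≋ ⟩
        r * ↧ x * (s * ↧ y)        ≡⟨ regroup r s (↧ x) (↧ y) ⟩
        r * s * (↧ x * ↧ y)        ≡⟨ cong (r * s *_) (ℤP.pos-* (↧ₙ x) (↧ₙ y)) ⟨
        r * s * + (↧ₙ x ℕ.* ↧ₙ y)  ∎)
      where
      open ≋-Reasoning
      regroup : ∀ r s u v → r * u * (s * v) ≡ r * s * (u * v)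
      regroup = solve-∀

    integer-reducesTo : ∀ k → + k / 1 reducesTo + k
    integer-reducesTo k = /-reducesTo (+ k) 1 p∤1 (≋-reflexive (sym (ℤP.*-identityʳ (+ k))))

    reciprocal-reducesTo : ∀ m .{{_ : NonZero m}} → ¬ p ℕD.∣ m → + 1 / m reducesTo inverse m
    reciprocal-reducesTo m p∤m = /-reducesTo (+ 1) m p∤m (begin
      1ℤ               ≈⟨ *-inverse p∤m ⟨
      + m * inverse m  ≡⟨ ℤP.*-comm (+ m) (inverse m) ⟩
      inverse m * + m  ∎)
      where open ≋-Reasoning

    ^-reducesTo : ∀ {x r} k → x reducesTo r → x ^ℚ k reducesTo r ^ k
    ^-reducesTo zero    x↦r = integer-reducesTo 1
    ^-reducesTo (suc k) x↦r = *-reducesTo x↦r (^-reducesTo k x↦r)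

    sumTo-reducesTo : ∀ n {f g} → (∀ k → k ℕ.≤ n → f k reducesTo g k) → sumTo n f reducesTo Σ< (suc n) g
    sumTo-reducesTo zero    {g = g} f↦g = reducesTo-resp-≋ (f↦g 0 ℕ.z≤n) (≋-reflexive (sym (ℤP.+-identityˡ (g 0))))
    sumTo-reducesTo (suc n)         f↦g =
      +-reducesTo (sumTo-reducesTo n (λ k k≤n → f↦g k (ℕP.m≤n⇒m≤1+n k≤n))) (f↦g (suc n) ℕP.≤-refl)

    reducesTo-0⇒≡0 : ∀ {x} → x reducesTo 0ℤ → x ≡ 0ℚ [modℚ p ^ 1 ]
    reducesTo-0⇒≡0 {x} (reduction p∤↧ ↥≋0) =
      subst (λ y → p ℕ.^ 1 ℕD.∣ ℤ.∣ ↥ y ∣ × ¬ p ℕD.∣ ↧ₙ y) (sym (ℚP.+-identityʳ x))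
        (subst (ℕD._∣ ℤ.∣ ↥ x ∣) (sym (ℕP.*-identityʳ p)) (to ≋0⇔∣ ↥≋0) , p∤↧)

    rising-reducesTo : ∀ {a r} k → a reducesTo r → rising a k reducesTo risingℤ r k
    rising-reducesTo zero    a↦r = integer-reducesTo 1
    rising-reducesTo (suc k) a↦r = *-reducesTo (rising-reducesTo k a↦r) (+-reducesTo a↦r (integer-reducesTo k))

  module HarmonicResidues (p : ℕ) (p-prime : Prime p) where

    open PrimeModulus p p-prime
    open Reduction p p-prime

    invSquare : ℕ → ℤ
    invSquare j = inverse (j ℕ.* j)

    H2ᵣ : ℕ → ℤ
    H2ᵣ m = Σ< m (invSquare ∘ suc)

    H2-reducesTo : ∀ m → m ℕ.< p → H2 m reducesTo H2ᵣ m
    H2-reducesTo zero    _     = integer-reducesTo 0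
    H2-reducesTo (suc m) 1+m<p =
      +-reducesTo (H2-reducesTo m (ℕP.<-trans (ℕP.n<1+n m) 1+m<p))
                  (reciprocal-reducesTo (suc m ℕ.* suc m) (∤-* (∤-<p 1+m<p) (∤-<p 1+m<p)))

    invSquare-cong : ∀ {a b} → ¬ p ℕD.∣ b → + (a ℕ.* a) ≋ + (b ℕ.* b) → invSquare a ≋ invSquare b
    invSquare-cong p∤b a²≋b² = inverse-cong (∤-resp-≋ a²≋b² p∤b²) p∤b² a²≋b²
      where
      p∤b² : ¬ p ℕD.∣ _
      p∤b² = ∤-* p∤b p∤b

    square-cong : ∀ {a b} → + a ≋ b → + (a ℕ.* a) ≋ b * b
    square-cong {a} a≋b = ≋-trans (≋-reflexive (ℤP.pos-* a a)) (*-cong a≋b a≋b)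

    square-reflect : ∀ a b → a ℕ.+ b ≡ p → + (a ℕ.* a) ≋ + (b ℕ.* b)
    square-reflect a b a+b≡p = ≋-trans (square-cong a≋-b) (≋-reflexive (trans (neg-square (+ b)) (sym (ℤP.pos-* b b))))
      where
      open ≋-Reasoning
      neg-square : ∀ b → - b * - b ≡ b * b
      neg-square = solve-∀
      a≋-b : + a ≋ - + b
      a≋-b = +≋0⇒≋- (begin
        + a + + b    ≡⟨ ℤP.pos-+ a b ⟨
        + (a ℕ.+ b)  ≡⟨ cong +_ a+b≡p ⟩
        + p          ≈⟨ m≋0 ⟩
        0ℤ           ∎)

    square-shift : ∀ a b → a ≡ p ℕ.+ b → + (a ℕ.* a) ≋ + (b ℕ.* b)
    square-shift a b a≡p+b = ≋-trans (square-cong a≋b) (≋-reflexive (sym (ℤP.pos-* b b)))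
      where
      open ≋-Reasoning
      a≋b : + a ≋ + b
      a≋b = begin
        + a          ≡⟨ cong +_ a≡p+b ⟩
        + (p ℕ.+ b)  ≡⟨ ℤP.pos-+ p b ⟩
        + p + + b    ≈⟨ +-cong m≋0 (≋-refl {+ b}) ⟩
        0ℤ + + b     ≡⟨ ℤP.+-identityˡ (+ b) ⟩
        + b          ∎

    4*invSquare-double : ∀ {a} → ¬ p ℕD.∣ 2 → ¬ p ℕD.∣ a → + 4 * invSquare (a ℕ.+ a) ≋ invSquare a
    4*invSquare-double {a} p∤2 p∤a = inverse-unique (∤-* p∤a p∤a) (begin
      + (a ℕ.* a) * (+ 4 * invSquare (a ℕ.+ a))  ≡⟨ cong (_* (+ 4 * invSquare (a ℕ.+ a))) (ℤP.pos-* a a) ⟩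
      + a * + a * (+ 4 * invSquare (a ℕ.+ a))    ≡⟨ quadruple (+ a) (invSquare (a ℕ.+ a)) ⟩
      (+ a + + a) * (+ a + + a) * invSquare (a ℕ.+ a)
                                               ≡⟨ cong (λ t → t * t * invSquare (a ℕ.+ a)) (ℤP.pos-+ a a) ⟨
      + (a ℕ.+ a) * + (a ℕ.+ a) * invSquare (a ℕ.+ a)
                                               ≡⟨ cong (_* invSquare (a ℕ.+ a)) (ℤP.pos-* (a ℕ.+ a) (a ℕ.+ a)) ⟨
      + ((a ℕ.+ a) ℕ.* (a ℕ.+ a)) * invSquare (a ℕ.+ a)
                                               ≈⟨ *-inverse (∤-* p∤2a p∤2a) ⟩
      1ℤ                                       ∎)
      where
      open ≋-Reasoning
      quadruple : ∀ a z → a * a * (+ 4 * z) ≡ (a + a) * (a + a) * z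
      quadruple = solve-∀
      p∤2a : ¬ p ℕD.∣ a ℕ.+ a
      p∤2a = subst (λ t → ¬ p ℕD.∣ t) (cong (a ℕ.+_) (ℕP.+-identityʳ a)) (∤-* p∤2 p∤a)

  module OddPrime (p : ℕ) (p-prime : Prime p) (n : ℕ) (p≡1+2n : p ≡ suc (n ℕ.+ n)) (3<p : 3 ℕ.< p) where

    open PrimeModulus p p-prime
    open Reduction p p-prime
    open HarmonicResidues p p-prime
    open import Data.Rational using () renaming (_*_ to _*ℚ_)

    p∤2 : ¬ p ℕD.∣ 2
    p∤2 = ∤-<p (ℕP.<-trans (ℕP.n<1+n 2) 3<p)

    p∤3 : ¬ p ℕD.∣ 3
    p∤3 = ∤-<p 3<p

    ≤2n⇒<p : ∀ {x} → x ℕ.≤ n ℕ.+ n → x ℕ.< p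
    ≤2n⇒<p x≤2n = subst (_ ℕ.<_) (sym p≡1+2n) (ℕ.s≤s x≤2n)

    ≤n⇒<p : ∀ {k} → k ℕ.≤ n → k ℕ.< p
    ≤n⇒<p k≤n = ≤2n⇒<p (ℕP.≤-trans k≤n (ℕP.m≤m+n n n))

    ≤n⇒2*≤2n : ∀ {k} → k ℕ.≤ n → 2 ℕ.* k ℕ.≤ n ℕ.+ n
    ≤n⇒2*≤2n {k} k≤n = subst (2 ℕ.* k ℕ.≤_) (2*x≡x+x n) (ℕP.*-monoʳ-≤ 2 k≤n)

    H2ᵣ-reflect : ∀ m → m ℕ.≤ n ℕ.+ n → H2ᵣ (n ℕ.+ n ∸ m) + H2ᵣ m ≋ H2ᵣ (n ℕ.+ n)
    H2ᵣ-reflect zero    _      = ≋-reflexive (ℤP.+-identityʳ _)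
    H2ᵣ-reflect (suc m) 1+m≤2n = begin
      H2ᵣ j + (H2ᵣ m + invSquare (suc m))  ≈⟨ +-cong (≋-refl {H2ᵣ j}) (+-cong (≋-refl {H2ᵣ m}) paired) ⟩
      H2ᵣ j + (H2ᵣ m + invSquare (suc j))  ≡⟨ swap (H2ᵣ j) (H2ᵣ m) (invSquare (suc j)) ⟩
      H2ᵣ (suc j) + H2ᵣ m                  ≡⟨ cong (λ t → H2ᵣ t + H2ᵣ m) 2n∸m≡1+j ⟨
      H2ᵣ (n ℕ.+ n ∸ m) + H2ᵣ m            ≈⟨ H2ᵣ-reflect m (ℕP.<⇒≤ 1+m≤2n) ⟩
      H2ᵣ (n ℕ.+ n)                        ∎
      where
      open ≋-Reasoning
      j : ℕ
      j = n ℕ.+ n ∸ suc m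
      2n∸m≡1+j : n ℕ.+ n ∸ m ≡ suc j
      2n∸m≡1+j = ℕP.+-∸-assoc 1 1+m≤2n
      1+j≤2n : suc j ℕ.≤ n ℕ.+ n
      1+j≤2n = subst (ℕ._≤ n ℕ.+ n) 2n∸m≡1+j (ℕP.m∸n≤m (n ℕ.+ n) m)
      1+m+1+j≡p : suc m ℕ.+ suc j ≡ p
      1+m+1+j≡p = trans (ℕP.+-suc (suc m) j) (trans (cong suc (ℕP.m+[n∸m]≡n 1+m≤2n)) (sym p≡1+2n))
      paired : invSquare (suc m) ≋ invSquare (suc j)
      paired = invSquare-cong {suc m} {suc j} (∤-<p (≤2n⇒<p 1+j≤2n)) (square-reflect (suc m) (suc j) 1+m+1+j≡p)
      swap : ∀ x y z → x + (y + z) ≡ (x + z) + y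
      swap = solve-∀

    -- The doubles 2, 4, …, 4n are the even residues followed by p + 1, p + 3, …, i.e. the odd ones.
    H2ᵣ[2n]≋0 : H2ᵣ (n ℕ.+ n) ≋ 0ℤ
    H2ᵣ[2n]≋0 = unit-*≋0⇒≋0 p∤3 (begin
      + 3 * H      ≡⟨ triple H ⟩
      + 4 * H - H  ≈⟨ +-cong 4H≋H (≋-refl { - H}) ⟩
      H - H        ≡⟨ ℤP.+-inverseʳ H ⟩
      0ℤ           ∎)
      where
      open ≋-Reasoning
      triple : ∀ x → + 3 * x ≡ + 4 * x - x
      triple = solve-∀
      H odds evens doubles wrapped : ℤ
      H       = H2ᵣ (n ℕ.+ n)
      odds    = Σ< n (λ i → invSquare (suc (i ℕ.+ i)))
      evens   = Σ< n (λ i → invSquare (suc (suc (i ℕ.+ i))))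
      doubles = Σ< (n ℕ.+ n) (λ i → invSquare (suc i ℕ.+ suc i))
      wrapped = Σ< n (λ i → invSquare (suc (n ℕ.+ i) ℕ.+ suc (n ℕ.+ i)))
      <n⇒odd<p : ∀ {i} → i ℕ.< n → suc (i ℕ.+ i) ℕ.< p
      <n⇒odd<p i<n = ≤2n⇒<p (ℕP.+-mono-≤ i<n (ℕP.<⇒≤ i<n))
      wrap : ∀ i → suc (n ℕ.+ i) ℕ.+ suc (n ℕ.+ i) ≡ p ℕ.+ suc (i ℕ.+ i)
      wrap i = trans (regroup n i) (cong (ℕ._+ suc (i ℕ.+ i)) (sym p≡1+2n))
        where
        regroup : ∀ n i → suc (n ℕ.+ i) ℕ.+ suc (n ℕ.+ i) ≡ suc (n ℕ.+ n) ℕ.+ suc (i ℕ.+ i)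
        regroup = ℕSolver.solve-∀
      doubles≋evens+odds : doubles ≋ evens + odds
      doubles≋evens+odds = begin
        doubles
          ≡⟨ Σ<-split n n (λ i → invSquare (suc i ℕ.+ suc i)) ⟩
        Σ< n (λ i → invSquare (suc i ℕ.+ suc i)) + wrapped
          ≡⟨ cong (_+ wrapped) (Σ<-cong n (λ i _ → cong (invSquare ∘ suc) (ℕP.+-suc i i))) ⟩
        evens + wrapped
          ≈⟨ +-cong (≋-refl {evens}) (Σ<-cong-≋ n (λ i i<n →
               invSquare-cong {suc (n ℕ.+ i) ℕ.+ suc (n ℕ.+ i)} (∤-<p (<n⇒odd<p i<n)) (square-shift _ _ (wrap i)))) ⟩
        evens + odds
          ∎
      4*doubles≋H : + 4 * doubles ≋ H
      4*doubles≋H = begin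
        + 4 * doubles
          ≡⟨ *-distribˡ-Σ< (n ℕ.+ n) (+ 4) (λ i → invSquare (suc i ℕ.+ suc i)) ⟩
        Σ< (n ℕ.+ n) (λ i → + 4 * invSquare (suc i ℕ.+ suc i))
          ≈⟨ Σ<-cong-≋ (n ℕ.+ n) (λ i i<2n → 4*invSquare-double p∤2 (∤-<p (≤2n⇒<p i<2n))) ⟩
        H ∎
      4H≋H : + 4 * H ≋ H
      4H≋H = begin
        + 4 * H               ≡⟨ cong (+ 4 *_) (trans (Σ<-even-odd n (invSquare ∘ suc)) (ℤP.+-comm odds evens)) ⟩
        + 4 * (evens + odds)  ≈⟨ *-cong (≋-refl {+ 4}) (≋-sym doubles≋evens+odds) ⟩
        + 4 * doubles         ≈⟨ 4*doubles≋H ⟩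
        H                     ∎

    H2ᵣ-antisymmetric : ∀ k → k ℕ.≤ n → H2ᵣ (2 ℕ.* (n ∸ k)) ≋ - H2ᵣ (2 ℕ.* k)
    H2ᵣ-antisymmetric k k≤n = +≋0⇒≋- (begin
      H2ᵣ (2 ℕ.* (n ∸ k)) + H2ᵣ (2 ℕ.* k)      ≡⟨ cong (λ t → H2ᵣ t + H2ᵣ (2 ℕ.* k)) 2[n∸k]≡2n∸2k ⟩
      H2ᵣ (n ℕ.+ n ∸ 2 ℕ.* k) + H2ᵣ (2 ℕ.* k)  ≈⟨ H2ᵣ-reflect (2 ℕ.* k) (≤n⇒2*≤2n k≤n) ⟩
      H2ᵣ (n ℕ.+ n)                            ≈⟨ H2ᵣ[2n]≋0 ⟩
      0ℤ                                       ∎)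
      where
      open ≋-Reasoning
      2[n∸k]≡2n∸2k : 2 ℕ.* (n ∸ k) ≡ n ℕ.+ n ∸ 2 ℕ.* k
      2[n∸k]≡2n∸2k = trans (ℕP.*-distribˡ-∸ 2 n k) (cong (ℕ._∸ 2 ℕ.* k) (2*x≡x+x n))

    inverse2≋-n : inverse 2 ≋ - + n
    inverse2≋-n = ≋-sym (inverse-unique p∤2 (begin
      + 2 * - + n  ≡⟨ rearrange (+ n) ⟩
      1ℤ - (1ℤ + (+ n + + n)) ≡⟨ cong (λ t → 1ℤ - t) 1+2n≡p ⟩
      1ℤ - + p  ≈⟨ +-cong (≋-refl {1ℤ}) (neg-cong m≋0) ⟩
      1ℤ - 0ℤ   ≡⟨ ℤP.+-identityʳ 1ℤ ⟩
      1ℤ        ∎))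
      where
      open ≋-Reasoning
      rearrange : ∀ n → + 2 * - n ≡ 1ℤ - (1ℤ + (n + n))
      rearrange = solve-∀
      1+2n≡p : 1ℤ + (+ n + + n) ≡ + p
      1+2n≡p = trans (cong (λ t → 1ℤ + t) (sym (ℤP.pos-+ n n)))
                     (trans (sym (ℤP.pos-+ 1 (n ℕ.+ n))) (cong +_ (sym p≡1+2n)))

    rising-half≋binomial : ∀ k → k ℕ.≤ n → risingℤ (inverse 2) k * inverse (k !) ≋ -1ℤ ^ k * + (n C k)
    rising-half≋binomial k k≤n = *-cancelʳ-≋ (∤⇒≉0 (∤-* p∤k! p∤[n∸k]!)) (begin
      risingℤ (inverse 2) k * inverse (k !) * + (k ! ℕ.* (n ∸ k) !)
        ≡⟨ cong (risingℤ (inverse 2) k * inverse (k !) *_) (ℤP.pos-* (k !) ((n ∸ k) !)) ⟩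
      risingℤ (inverse 2) k * inverse (k !) * (+ (k !) * + ((n ∸ k) !))
        ≡⟨ regroup (risingℤ (inverse 2) k) (inverse (k !)) (+ (k !)) (+ ((n ∸ k) !)) ⟩
      risingℤ (inverse 2) k * + ((n ∸ k) !) * (+ (k !) * inverse (k !))
        ≈⟨ *-cong (*-cong (risingℤ-cong k inverse2≋-n) ≋-refl) (*-inverse p∤k!) ⟩
      risingℤ (- + n) k * + ((n ∸ k) !) * 1ℤ
        ≡⟨ ℤP.*-identityʳ _ ⟩
      risingℤ (- + n) k * + ((n ∸ k) !)
        ≡⟨ [-n]ₖ*[n∸k]!≡[-1]^k*n! n k k≤n ⟩
      -1ℤ ^ k * + (n !)
        ≡⟨ cong (λ t → -1ℤ ^ k * + t) (nCk*k![n∸k]!≡n! k≤n) ⟨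
      -1ℤ ^ k * + ((n C k) ℕ.* (k ! ℕ.* (n ∸ k) !))
        ≡⟨ cong (-1ℤ ^ k *_) (ℤP.pos-* (n C k) (k ! ℕ.* (n ∸ k) !)) ⟩
      -1ℤ ^ k * (+ (n C k) * + (k ! ℕ.* (n ∸ k) !))
        ≡⟨ ℤP.*-assoc (-1ℤ ^ k) (+ (n C k)) _ ⟨
      -1ℤ ^ k * + (n C k) * + (k ! ℕ.* (n ∸ k) !)
        ∎)
      where
      open ≋-Reasoning
      p∤k! : ¬ p ℕD.∣ k !
      p∤k! = ∤-! (≤n⇒<p k≤n)
      p∤[n∸k]! : ¬ p ℕD.∣ (n ∸ k) !
      p∤[n∸k]! = ∤-! (≤n⇒<p (ℕP.m∸n≤m n k))
      regroup : ∀ r i a b → r * i * (a * b) ≡ r * b * (a * i)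
      regroup = solve-∀

    summand : ℕ → ℕ → ℚ
    summand s k = ((rising half k *ℚ invFact k) ^ℚ (2 ℕ.* s)) *ℚ H2 (2 ℕ.* k)

    termResidue : ℕ → ℕ → ℤ
    termResidue s k = (+ (n C k)) ^ (2 ℕ.* s) * H2ᵣ (2 ℕ.* k)

    summand-reducesTo : ∀ s k → k ℕ.≤ n → summand s k reducesTo termResidue s k
    summand-reducesTo s k k≤n = reducesTo-resp-≋
      (*-reducesTo (^-reducesTo (2 ℕ.* s) (*-reducesTo (rising-reducesTo k (reciprocal-reducesTo 2 p∤2))
                                                        (reciprocal-reducesTo (k !) {{k !≢0}} (∤-! (≤n⇒<p k≤n)))))
                   (H2-reducesTo (2 ℕ.* k) (≤2n⇒<p (≤n⇒2*≤2n k≤n))))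
      (*-cong coefficient≋ ≋-refl)
      where
      coefficient≋ : (risingℤ (inverse 2) k * inverse (k !)) ^ (2 ℕ.* s) ≋ (+ (n C k)) ^ (2 ℕ.* s)
      coefficient≋ = ≋-trans (^-cong (2 ℕ.* s) (rising-half≋binomial k k≤n))
                             (≋-reflexive ([-1]^k*x^[2s]≡x^[2s] k s (+ (n C k))))

    termResidue-antisymmetric : ∀ s k → k ℕ.≤ n → termResidue s (n ∸ k) ≋ - termResidue s k
    termResidue-antisymmetric s k k≤n = begin
      termResidue s (n ∸ k)         ≡⟨ cong (λ c → (+ c) ^ (2 ℕ.* s) * H2ᵣ (2 ℕ.* (n ∸ k))) (nCk≡nC[n∸k] k≤n) ⟨
      C²ˢ * H2ᵣ (2 ℕ.* (n ∸ k))     ≈⟨ *-cong (≋-refl {C²ˢ}) (H2ᵣ-antisymmetric k k≤n) ⟩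
      C²ˢ * - H2ᵣ (2 ℕ.* k)         ≡⟨ ℤP.neg-distribʳ-* C²ˢ (H2ᵣ (2 ℕ.* k)) ⟨
      - termResidue s k             ∎
      where
      open ≋-Reasoning
      C²ˢ : ℤ
      C²ˢ = (+ (n C k)) ^ (2 ℕ.* s)

    sumTo-summand≡0 : ∀ s → sumTo n (summand s) ≡ 0ℚ [modℚ p ^ 1 ]
    sumTo-summand≡0 s = reducesTo-0⇒≡0 (reducesTo-resp-≋ (sumTo-reducesTo n (summand-reducesTo s))
      (Σ<-antisymmetric p∤2 (suc n) (termResidue s) (λ k k<1+n → termResidue-antisymmetric s k (ℕP.≤-pred k<1+n))))

open import Data.Nat using (ℕ; _>_; _/_; _∸_; _*_)
open import Data.Nat.Primality using (Prime)
open import Data.Rational using (ℚ; 0ℚ) renaming (_*_ to _*ℚ_)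
open import Data.Nat.Properties using (<-trans; n<1+n)

mainTheorem8 : (p s : ℕ) → Prime p → p > 3 → s > 0 →
    sumTo ((p ∸ 1) / 2)
      (λ k → ((rising half k *ℚ invFact k) ^ℚ (2 * s)) *ℚ H2 (2 * k))
      ≡ 0ℚ [modℚ p ^ 1 ]
mainTheorem8 p s p-prime 3<p _ =
  OddPrime.sumTo-summand≡0 p p-prime ((p ∸ 1) / 2) (odd-prime≡1+2[p∸1]/2 p-prime (<-trans (n<1+n 2) 3<p)) 3<p s
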